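{- Let $x_1,\dots,x_k$ be independent binary random variables with range $\{\text{black},\text{white}\}$ and let $X$ be the number of $x_i$ that are black. For a threshold $x>0$ let $\mathcal E_x$ be the event $X>x$. Then the event $\mathcal E_{x/2}$ testifies risk $\Pr(\mathcal E_{x/2})$ for $\mathcal E_x$; in particular the risk of $\mathcal E_x$ is at most $\Pr(\mathcal E_{x/2})$.
   Context: A partial assignment gives each variable a value or $\bot$ (unset); $\psi$ is a retraction of $\varphi$ if $\psi(y)=\varphi(y)$ whenever $\psi(y)\ne\bot$. $\Pr(\mathcal E\mid\psi)$ is the probability of $\mathcal E$ with set variables fixed as in $\psi$ and unset ones random. For an event $\mathcal E'$, $\mathrm{Respect}(\mathcal E')$ is the set of partial assignments $\psi$ that are a retraction of some full assignment $\varphi$ avoiding $\mathcal E'$ and such that either all variables of $\mathrm{vbl}(\mathcal E')$ white under $\varphi$ are unset in $\psi$, or no variable of $\mathrm{vbl}(\mathcal E')$ black under $\varphi$ is unset in $\psi$. An event $\mathcal E'\supseteq\mathcal E$ testifies risk $r$ for $\mathcal E$ if $\max\{\Pr(\mathcal E'),\max_{\psi\in\mathrm{Respect}(\mathcal E')}\Pr(\mathcal E\mid\psi)\}\le r$; the risk of $\mathcal E$ is the least $r$ testified by some $\mathcal E'\supseteq\mathcal E$.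
   Formalization: The probabilities that each $x_i$ is black, and the threshold $x$, are rational. -}

module Defs where

open import Data.Bool using (Bool; true; false; if_then_else_)
open import Data.Maybe using (Maybe; just; nothing)
open import Data.Nat using (ℕ; zero; suc)
import Data.Nat as ℕ
open import Data.Fin using (Fin)
open import Data.Vec.Functional using (_∷_; tail)
open import Data.Rational using (ℚ; 0ℚ; 1ℚ; _+_; _*_; _-_; _≤_; _<_)
open import Data.Rational.Properties using (_<?_)
open import Data.Integer using (+_)
import Data.Rational as Q
open import Data.Product using (Σ; _×_)
open import Data.Sum using (_⊎_)
open import Relation.Nullary using (does; ¬_)
open import Relation.Binary.PropositionalEquality using (_≡_)

-- Variables x_1..x_k are indexed by Fin k; value true = black, false = white.
Assignment : ℕ → Set
Assignment k = Fin k → Bool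

-- Partial assignment: nothing = ⊥ (unset).
Partial : ℕ → Set
Partial k = Fin k → Maybe Bool

Event : ℕ → Set
Event k = Assignment k → Bool

_⊆E_ : ∀ {k} → Event k → Event k → Set
E ⊆E E' = ∀ φ → E φ ≡ true → E' φ ≡ true

IsRetraction : ∀ {k} → Partial k → Assignment k → Set
IsRetraction ψ φ = ∀ i b → ψ i ≡ just b → φ i ≡ b

-- p i = Pr(x_i is black); variables are independent.
-- Pr(E ∣ ψ): set variables fixed as in ψ, unset ones independent random.
PrCond : ∀ {k} → (Fin k → ℚ) → Partial k → Event k → ℚ
PrCond {zero}  p ψ E = if E (λ ()) then 1ℚ else 0ℚ
PrCond {suc k} p ψ E with ψ Fin.zero
... | just b  = PrCond (tail p) (tail ψ) (λ φ → E (b ∷ φ))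
... | nothing = p Fin.zero * PrCond (tail p) (tail ψ) (λ φ → E (true ∷ φ))
              + (1ℚ - p Fin.zero) * PrCond (tail p) (tail ψ) (λ φ → E (false ∷ φ))

Pr : ∀ {k} → (Fin k → ℚ) → Event k → ℚ
Pr p E = PrCond p (λ _ → nothing) E

-- Respect(E'), where vbl(E') is given as a subset V of the variables.
Respect : ∀ {k} → Event k → (Fin k → Bool) → Partial k → Set
Respect {k} E' V ψ =
  Σ (Assignment k) λ φ →
    (E' φ ≡ false) × IsRetraction ψ φ ×
    ( (∀ i → V i ≡ true → φ i ≡ false → ψ i ≡ nothing)
    ⊎ (∀ i → V i ≡ true → φ i ≡ true → ¬ (ψ i ≡ nothing)) )

Testifies : ∀ {k} → (Fin k → ℚ) → Event k → Event k → (Fin k → Bool) → ℚ → Set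
Testifies p E E' V r =
  (E ⊆E E') × (Pr p E' ≤ r) × (∀ ψ → Respect E' V ψ → PrCond p ψ E ≤ r)

countBlack : ∀ {k} → Assignment k → ℕ
countBlack {zero}  φ = zero
countBlack {suc k} φ = (if φ Fin.zero then 1 else 0) ℕ.+ countBlack (tail φ)

Exceeds : ∀ {k} → ℚ → Event k
Exceeds t φ = does (t <? (+ countBlack φ) Q./ 1)

allVars : ∀ {k} → Fin k → Bool
allVars _ = true

{-# OPTIONS --safe #-}
-- Let φ₀ be an assignment avoiding E_{x/2} of which ψ is a retraction, so at most x/2 of the
-- variables set by ψ are black.  Couple the conditional distribution given ψ with an
-- unconditional sample φ′ by letting both share the values of the variables unset in ψ.
-- If the conditional sample has more than x black variables, more than x/2 of them are
-- unset, and these are black in φ′ too; hence Pr(E_x ∣ ψ) ≤ Pr(E_{x/2}).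
module Submission where

open import Defs
open import Data.Nat using (ℕ)
open import Data.Fin using (Fin)
open import Data.Rational using (ℚ; 0ℚ; 1ℚ; ½; _*_; _≤_; _<_)
open import Data.Product using (_×_)

open import Data.Bool using (Bool; true; false; if_then_else_)
open import Data.Fin using (zero; suc)
open import Data.Integer as ℤ using (+_; +≤+)
import Data.Integer.Properties as ℤₚ
open import Data.Maybe using (just; nothing)
open import Data.Maybe.Properties using (just-injective)
import Data.Nat as ℕ
import Data.Nat.Properties as ℕₚ
open import Data.Nat.Coprimality as Coprime using (1-coprimeTo)
open import Data.Product using (_,_; proj₁; proj₂)
open import Data.Rational using (_+_; _-_; -_; mkℚ; toℚᵘ; _/_; *≤*; nonNegative)
open import Data.Rational.Properties
import Data.Rational.Unnormalised as ℚᵘ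
import Data.Rational.Unnormalised.Properties as ℚᵘₚ
open import Data.Rational.Solver using (module +-*-Solver)
open import Data.Sum using (_⊎_; inj₁; inj₂)
open import Data.Vec.Functional using (_∷_; tail)
open import Function using (_∘_)
open import Relation.Nullary using (Dec; yes; no; does; ¬_)
open import Relation.Nullary.Decidable using (dec-true)
open import Relation.Binary.PropositionalEquality using (_≡_; refl; sym; trans; subst; cong; cong₂)
open import Algebra.Properties.CommutativeSemigroup ℕₚ.+-commutativeSemigroup using (interchange)

p≤1⇒0≤1-p : ∀ {c} → c ≤ 1ℚ → 0ℚ ≤ 1ℚ - c
p≤1⇒0≤1-p {c} c≤1 = subst (_≤ 1ℚ - c) (+-inverseʳ c) (+-monoˡ-≤ (- c) c≤1)

convex-mono-≤ : ∀ {c a b u v} → 0ℚ ≤ c → c ≤ 1ℚ → a ≤ u → b ≤ v →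
  c * a + (1ℚ - c) * b ≤ c * u + (1ℚ - c) * v
convex-mono-≤ {c} 0≤c c≤1 a≤u b≤v = +-mono-≤
  (*-monoˡ-≤-nonNeg c {{nonNegative 0≤c}} a≤u)
  (*-monoˡ-≤-nonNeg (1ℚ - c) {{nonNegative (p≤1⇒0≤1-p c≤1)}} b≤v)

convex-diag : ∀ c a → c * a + (1ℚ - c) * a ≡ a
convex-diag = solve 2 (λ c a → c :* a :+ (con 1ℚ :- c) :* a := a) refl
  where open +-*-Solver

≤-convex : ∀ {c a u v} → 0ℚ ≤ c → c ≤ 1ℚ → a ≤ u → a ≤ v → a ≤ c * u + (1ℚ - c) * v
≤-convex {c} {a} 0≤c c≤1 a≤u a≤v = subst (_≤ _) (convex-diag c a) (convex-mono-≤ 0≤c c≤1 a≤u a≤v)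

+-cancelˡ-<-≤ : ∀ {a b s u} → a ≤ s → s + u < a + b → u < b
+-cancelˡ-<-≤ a≤s s+u<a+b = ≰⇒> λ b≤u → <-irrefl refl (<-≤-trans s+u<a+b (+-mono-≤ a≤s b≤u))

p*½+p*½≡p : ∀ p → p * ½ + p * ½ ≡ p
p*½+p*½≡p p = trans (sym (*-distribˡ-+ p ½ ½)) (*-identityʳ p)

p*½≤p : ∀ {p} → 0ℚ ≤ p → p * ½ ≤ p
p*½≤p {p} 0≤p = subst (p * ½ ≤_) (*-identityʳ p) (*-monoˡ-≤-nonNeg p {{nonNegative 0≤p}} (≤ᵇ⇒≤ _))

toℚ : ℕ → ℚ
toℚ n = + n / 1

-- + n / 1 is stuck on a gcd computation; rewriting with this exposes the numerator.
toℚ≡mkℚ : ∀ n → toℚ n ≡ mkℚ (+ n) 0 (Coprime.sym (1-coprimeTo n))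
toℚ≡mkℚ n = normalize-coprime (Coprime.sym (1-coprimeTo n))

toℚ-mono-≤ : ∀ {m n} → m ℕ.≤ n → toℚ m ≤ toℚ n
toℚ-mono-≤ {m} {n} m≤n rewrite toℚ≡mkℚ m | toℚ≡mkℚ n = *≤* (ℤₚ.*-monoʳ-≤-nonNeg (+ 1) (+≤+ m≤n))

toℚ-homo-+ : ∀ m n → toℚ (m ℕ.+ n) ≡ toℚ m + toℚ n
toℚ-homo-+ m n = toℚᵘ-injective (ℚᵘₚ.≃-trans lhs≃ (ℚᵘₚ.≃-sym (toℚᵘ-homo-+ (toℚ m) (toℚ n))))
  where
  lhs≃ : toℚᵘ (toℚ (m ℕ.+ n)) ℚᵘ.≃ toℚᵘ (toℚ m) ℚᵘ.+ toℚᵘ (toℚ n)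
  lhs≃ rewrite toℚ≡mkℚ m | toℚ≡mkℚ n | toℚ≡mkℚ (m ℕ.+ n) =
    ℚᵘ.*≡* (cong (ℤ._* + 1) (sym (cong₂ ℤ._+_ (ℤₚ.*-identityʳ (+ m)) (ℤₚ.*-identityʳ (+ n)))))

does≡true⇒ : ∀ {P : Set} (P? : Dec P) → does P? ≡ true → P
does≡true⇒ (yes p) _  = p
does≡true⇒ (no _)  ()

does≡false⇒¬ : ∀ {P : Set} (P? : Dec P) → does P? ≡ false → ¬ P
does≡false⇒¬ (yes _) ()
does≡false⇒¬ (no ¬p) _  = ¬p

exceeds⇒< : ∀ {k t} {φ : Assignment k} → Exceeds t φ ≡ true → t < toℚ (countBlack φ)
exceeds⇒< {t = t} {φ} = does≡true⇒ (t <? toℚ (countBlack φ))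

<⇒exceeds : ∀ {k t} {φ : Assignment k} → t < toℚ (countBlack φ) → Exceeds t φ ≡ true
<⇒exceeds {t = t} {φ} = dec-true (t <? toℚ (countBlack φ))

¬exceeds⇒≤ : ∀ {k t} {φ : Assignment k} → Exceeds t φ ≡ false → toℚ (countBlack φ) ≤ t
¬exceeds⇒≤ {t = t} {φ} = ≮⇒≥ ∘ does≡false⇒¬ (t <? toℚ (countBlack φ))

Exceeds-antitone : ∀ {k s t} → s ≤ t → Exceeds {k} t ⊆E Exceeds s
Exceeds-antitone {s = s} {t} s≤t φ e = <⇒exceeds {t = s} {φ} (≤-<-trans s≤t (exceeds⇒< {t = t} {φ} e))

indicator : Bool → ℕ
indicator b = if b then 1 else 0

indicator-≤-+ : ∀ a {b c} → (a ≡ true → b ≡ true ⊎ c ≡ true) → indicator a ℕ.≤ indicator b ℕ.+ indicator c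
indicator-≤-+ false                 _ = ℕ.z≤n
indicator-≤-+ true  {true}          _ = ℕ.s≤s ℕ.z≤n
indicator-≤-+ true  {false} {true}  _ = ℕ.s≤s ℕ.z≤n
indicator-≤-+ true  {false} {false} a⇒b∨c with a⇒b∨c refl
... | inj₁ ()
... | inj₂ ()

countBlack-≤-+ : ∀ {k} {φ φ₁ φ₂ : Assignment k} → (∀ i → φ i ≡ true → φ₁ i ≡ true ⊎ φ₂ i ≡ true) →
  countBlack φ ℕ.≤ countBlack φ₁ ℕ.+ countBlack φ₂
countBlack-≤-+ {ℕ.zero} _ = ℕ.z≤n
countBlack-≤-+ {ℕ.suc k} {φ} {φ₁} {φ₂} covered = ℕₚ.≤-trans
  (ℕₚ.+-mono-≤ (indicator-≤-+ (φ zero) (covered zero)) (countBlack-≤-+ (covered ∘ suc)))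
  (ℕₚ.≤-reflexive (interchange (indicator (φ₁ zero)) (indicator (φ₂ zero)) _ _))

indicatorℚ-mono : ∀ {a b : Bool} → (a ≡ true → b ≡ true) →
  (if a then 1ℚ else 0ℚ) ≤ (if b then 1ℚ else 0ℚ)
indicatorℚ-mono {false} {false} _ = ≤-refl
indicatorℚ-mono {false} {true}  _ = *≤* (+≤+ ℕ.z≤n)
indicatorℚ-mono {true}  {true}  _ = ≤-refl
indicatorℚ-mono {true}  {false} a⇒b with () ← a⇒b refl

AgreeOnUnset : ∀ {k} → Partial k → Assignment k → Assignment k → Set
AgreeOnUnset ψ φ φ′ = ∀ i → ψ i ≡ nothing → φ′ i ≡ φ i

-- Sample φ given ψ and φ′ unconditionally, sharing the variables unset in ψ: φ ∈ E forces φ′ ∈ F.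
Coupled : ∀ {k} → Partial k → Event k → Event k → Set
Coupled {k} ψ E F = ∀ (φ φ′ : Assignment k) →
  IsRetraction ψ φ → AgreeOnUnset ψ φ φ′ → E φ ≡ true → F φ′ ≡ true

Coupled-tail : ∀ {k} {ψ : Partial (ℕ.suc k)} {E F : Event (ℕ.suc k)} {b c : Bool} →
  (∀ b′ → ψ zero ≡ just b′ → b ≡ b′) → (ψ zero ≡ nothing → c ≡ b) →
  Coupled ψ E F → Coupled (tail ψ) (λ φ → E (b ∷ φ)) (λ φ → F (c ∷ φ))
Coupled-tail {ψ = ψ} {b = b} {c} b-fits c-agrees coupled φ φ′ ψ⊑φ φ≈φ′ =
  coupled (b ∷ φ) (c ∷ φ′) ψ⊑bφ bφ≈cφ′
  where
  ψ⊑bφ : IsRetraction ψ (b ∷ φ)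
  ψ⊑bφ zero    = b-fits
  ψ⊑bφ (suc i) = ψ⊑φ i
  bφ≈cφ′ : AgreeOnUnset ψ (b ∷ φ) (c ∷ φ′)
  bφ≈cφ′ zero    = c-agrees
  bφ≈cφ′ (suc i) = φ≈φ′ i

PrCond≤Pr : ∀ {k} (p : Fin k → ℚ) → (∀ i → (0ℚ ≤ p i) × (p i ≤ 1ℚ)) →
  (ψ : Partial k) {E F : Event k} → Coupled ψ E F → PrCond p ψ E ≤ Pr p F
PrCond≤Pr {ℕ.zero}  p _ ψ coupled = indicatorℚ-mono (coupled _ _ (λ ()) (λ ()))
PrCond≤Pr {ℕ.suc k} p p∈[0,1] ψ {E} {F} coupled with ψ zero in ψ₀≡
... | just b = ≤-convex (proj₁ (p∈[0,1] zero)) (proj₂ (p∈[0,1] zero)) (rec true) (rec false)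
  where
  rec : ∀ c → PrCond (tail p) (tail ψ) (λ φ → E (b ∷ φ)) ≤ Pr (tail p) (λ φ → F (c ∷ φ))
  rec c = PrCond≤Pr (tail p) (p∈[0,1] ∘ suc) (tail ψ) (Coupled-tail b-fits c-agrees coupled)
    where
    b-fits : ∀ b′ → ψ zero ≡ just b′ → b ≡ b′
    b-fits b′ ψ₀≡b′ = just-injective (trans (sym ψ₀≡) ψ₀≡b′)
    c-agrees : ψ zero ≡ nothing → c ≡ b
    c-agrees ψ₀≡nothing with () ← trans (sym ψ₀≡) ψ₀≡nothing
... | nothing = convex-mono-≤ (proj₁ (p∈[0,1] zero)) (proj₂ (p∈[0,1] zero)) (rec true) (rec false)
  where
  rec : ∀ c → PrCond (tail p) (tail ψ) (λ φ → E (c ∷ φ)) ≤ Pr (tail p) (λ φ → F (c ∷ φ))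
  rec c = PrCond≤Pr (tail p) (p∈[0,1] ∘ suc) (tail ψ) (Coupled-tail c-fits (λ _ → refl) coupled)
    where
    c-fits : ∀ b′ → ψ zero ≡ just b′ → c ≡ b′
    c-fits b′ ψ₀≡b′ with () ← trans (sym ψ₀≡) ψ₀≡b′

black-covered : ∀ {k} {ψ : Partial k} {φ₀ φ φ′ : Assignment k} →
  IsRetraction ψ φ₀ → IsRetraction ψ φ → AgreeOnUnset ψ φ φ′ →
  ∀ i → φ i ≡ true → φ₀ i ≡ true ⊎ φ′ i ≡ true
black-covered {ψ = ψ} ψ⊑φ₀ ψ⊑φ φ≈φ′ i φᵢ≡ with ψ i in ψᵢ≡
... | just b  = inj₁ (trans (ψ⊑φ₀ i b ψᵢ≡) (trans (sym (ψ⊑φ i b ψᵢ≡)) φᵢ≡))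
... | nothing = inj₂ (trans (φ≈φ′ i ψᵢ≡) φᵢ≡)

Exceeds-coupled : ∀ {k} {ψ : Partial k} {φ₀ : Assignment k} {s t u} → s + u ≤ t →
  Exceeds s φ₀ ≡ false → IsRetraction ψ φ₀ → Coupled ψ (Exceeds t) (Exceeds u)
Exceeds-coupled {φ₀ = φ₀} {s} {t} {u} s+u≤t φ₀∉ ψ⊑φ₀ φ φ′ ψ⊑φ φ≈φ′ φ∈ =
  <⇒exceeds {t = u} {φ′} (+-cancelˡ-<-≤ (¬exceeds⇒≤ {t = s} {φ₀} φ₀∉) (begin-strict
    s + u                                     ≤⟨ s+u≤t ⟩
    t                                         <⟨ exceeds⇒< {t = t} {φ} φ∈ ⟩
    toℚ (countBlack φ)                        ≤⟨ toℚ-mono-≤ (countBlack-≤-+ (black-covered ψ⊑φ₀ ψ⊑φ φ≈φ′)) ⟩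
    toℚ (countBlack φ₀ ℕ.+ countBlack φ′)     ≡⟨ toℚ-homo-+ (countBlack φ₀) (countBlack φ′) ⟩
    toℚ (countBlack φ₀) + toℚ (countBlack φ′) ∎))
  where open ≤-Reasoning

lemmaL : (k : ℕ) (p : Fin k → ℚ) → (∀ i → (0ℚ ≤ p i) × (p i ≤ 1ℚ)) →
    (x : ℚ) → 0ℚ < x →
    Testifies p (Exceeds x) (Exceeds (x * ½)) allVars (Pr p (Exceeds (x * ½)))
lemmaL _ p p∈[0,1] x 0<x = Exceeds-antitone (p*½≤p (<⇒≤ 0<x)) , ≤-refl , bounded
  where
  bounded : ∀ ψ → Respect (Exceeds (x * ½)) allVars ψ → PrCond p ψ (Exceeds x) ≤ Pr p (Exceeds (x * ½))
  bounded ψ (φ₀ , φ₀∉ , ψ⊑φ₀ , _) =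
    PrCond≤Pr p p∈[0,1] ψ (Exceeds-coupled {s = x * ½} {x} {x * ½} (≤-reflexive (p*½+p*½≡p x)) φ₀∉ ψ⊑φ₀)
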